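{- Let $\mathcal{M}'_1=(\mathcal{N}',\mathcal{I}'_1,w)$, $\mathcal{M}'_2=(\mathcal{N}',\mathcal{I}'_2,w)$ be weighted matroids with $w(e)\in\{1,\dots,W\}$, with maximum weight of a common independent set $\mathrm{OPT}'$. Let $\mathcal{M}_1,\mathcal{M}_2$ be the unfolded instance with maximum cardinality of a common independent set $\mathrm{OPT}$. Then $\mathrm{OPT}\ge\mathrm{OPT}'$.
   Context: Unfolding: the ground set $\mathcal{N}$ consists of copies $e_1,\dots,e_{w(e)}$ for each $e\in\mathcal{N}'$. For $I\subseteq\mathcal{N}$ and $i\in[W]$ let $I'_{1,i}=\{e: e_i\in I\}$ and $I'_{2,i}=\{e: e_{w(e)-i+1}\in I\}$. Then $I\in\mathcal{I}_1$ iff $I'_{1,i}\in\mathcal{I}'_1$ for all $i\in[W]$, and $I\in\mathcal{I}_2$ iff $I'_{2,i}\in\mathcal{I}'_2$ for all $i\in[W]$. -}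

module Defs where

open import Data.Nat using (ℕ; zero; suc; _+_; _∸_; _<_; _≤_)
open import Data.Nat.Properties using (_<?_; m∸n≤m)
open import Data.Nat using (s≤s)
open import Data.Fin using (Fin; toℕ; fromℕ<)
import Data.Fin as F
open import Data.Fin.Subset using (Subset; _⊆_; _∈_; _∉_; _∪_; ⁅_⁆; ∣_∣; ⊥)
open import Data.Fin.Subset.Properties using (_∈?_)
open import Data.Vec using (lookup; tabulate)
open import Data.Bool using (Bool; true; false)
open import Data.Product using (∃; _×_)
open import Relation.Nullary using (yes; no)

sumFin : (n : ℕ) → (Fin n → ℕ) → ℕ
sumFin zero    f = 0
sumFin (suc n) f = f F.zero + sumFin n (λ i → f (F.suc i))

record Matroid (n : ℕ) : Set₁ where
  field
    Indep    : Subset n → Set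
    indep-∅  : Indep ⊥
    indep-⊆  : ∀ {A B} → A ⊆ B → Indep B → Indep A
    exchange : ∀ {A B} → Indep A → Indep B → ∣ A ∣ < ∣ B ∣ →
               ∃ λ x → x ∈ B × x ∉ A × Indep (A ∪ ⁅ x ⁆)
open Matroid public

weight : {n : ℕ} → (Fin n → ℕ) → Subset n → ℕ
weight {n} w I = sumFin n (λ e → wt e)
  where
  wt : Fin n → ℕ
  wt e with e ∈? I
  ... | yes _ = w e
  ... | no  _ = 0

-- Unfolded ground set: element e has copies e_1,…,e_{w(e)}, the copy e_j
-- (1-indexed) being represented by the index j-1 : Fin (w e).
USubset : {n : ℕ} → (Fin n → ℕ) → Set
USubset {n} w = (e : Fin n) → Subset (w e)

ucard : {n : ℕ} {w : Fin n → ℕ} → USubset w → ℕ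
ucard {n} {w} I = sumFin n (λ e → ∣ I e ∣)

-- I'_{1,i} = { e : e_i ∈ I }, for 1-indexed i = k+1 (k = 0-indexed).
layer₁ : {n : ℕ} {w : Fin n → ℕ} → USubset w → ℕ → Subset n
layer₁ {n} {w} I k = tabulate f
  where
  f : Fin n → Bool
  f e with k <? w e
  ... | yes p = lookup (I e) (fromℕ< p)
  ... | no  _ = false

rev< : ∀ {k m} → k < m → m ∸ suc k < m
rev< {k} {suc m} (s≤s _) = s≤s (m∸n≤m m k)

-- I'_{2,i} = { e : e_{w(e)-i+1} ∈ I }, for 1-indexed i = k+1; the copy
-- e_{w(e)-k} has 0-indexed position w(e) - k - 1 = w e ∸ suc k.
layer₂ : {n : ℕ} {w : Fin n → ℕ} → USubset w → ℕ → Subset n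
layer₂ {n} {w} I k = tabulate f
  where
  f : Fin n → Bool
  f e with k <? w e
  ... | yes p = lookup (I e) (fromℕ< (rev< p))
  ... | no  _ = false

-- Independence in the unfolded matroids, for i ranging over [W]
-- (Fin W, with i : Fin W standing for the 1-indexed value toℕ i + 1).
UIndep₁ : {n : ℕ} (W : ℕ) (w : Fin n → ℕ) → Matroid n → USubset w → Set
UIndep₁ W w M I = (i : Fin W) → Indep M (layer₁ I (toℕ i))

UIndep₂ : {n : ℕ} (W : ℕ) (w : Fin n → ℕ) → Matroid n → USubset w → Set
UIndep₂ W w M I = (i : Fin W) → Indep M (layer₂ I (toℕ i))

{-# OPTIONS --safe #-}
module Submission where

-- Take every copy of every element of I'. The resulting set has cardinality
-- weight w I', and each of its layers is contained in I', hence independent.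

open import Defs
open import Data.Nat using (ℕ; zero; suc; _+_; _≤_)
open import Data.Nat.Properties using (_<?_; ≤-reflexive)
open import Data.Fin using (Fin; toℕ; fromℕ<)
import Data.Fin as F
open import Data.Fin.Subset using (Subset; Nonempty; _⊆_; _∈_; ⊤; ⊥; ∣_∣)
open import Data.Fin.Subset.Properties using (_∈?_; ∉⊥; ∣⊤∣≡n; ∣⊥∣≡0)
open import Data.Bool using (Bool; true)
open import Data.Vec using (tabulate)
open import Data.Vec.Properties using (lookup∘tabulate; []=⇒lookup; lookup⇒[]=)
open import Data.Product using (Σ; _×_; _,_)
open import Function using (_∘_)
open import Relation.Nullary using (yes; no; contradiction)
open import Relation.Binary.PropositionalEquality using (_≡_; _≗_; refl; sym; trans; cong₂)

sumFin-cong : ∀ n {f g : Fin n → ℕ} → f ≗ g → sumFin n f ≡ sumFin n g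
sumFin-cong zero    f≗g = refl
sumFin-cong (suc n) f≗g = cong₂ _+_ (f≗g F.zero) (sumFin-cong n (f≗g ∘ F.suc))

∈-tabulate⁻ : ∀ {n} {f : Fin n → Bool} {x} → x ∈ tabulate f → f x ≡ true
∈-tabulate⁻ {f = f} {x} x∈ = trans (sym (lookup∘tabulate f x)) ([]=⇒lookup x∈)

-- The summand of weight is local to its definition in Defs; it is recovered
-- here by unification against the unfolded sum.
weight-summand : ∀ {n} (w : Fin n → ℕ) (I : Subset n) → Fin n → ℕ
weight-summand {n} w I = summand (weight w I) refl
  where
  summand : ∀ {f} (s : ℕ) → s ≡ sumFin n f → Fin n → ℕ
  summand {f} _ _ = f

module _ {n : ℕ} {w : Fin n → ℕ} (I : USubset w) (k : ℕ) where

  layer₁-nonempty : ∀ {e} → e ∈ layer₁ I k → Nonempty (I e)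
  layer₁-nonempty {e} e∈ with k <? w e | ∈-tabulate⁻ e∈
  ... | yes k<we | copy∈ = fromℕ< k<we , lookup⇒[]= _ (I e) copy∈
  ... | no _     | ()

  layer₂-nonempty : ∀ {e} → e ∈ layer₂ I k → Nonempty (I e)
  layer₂-nonempty {e} e∈ with k <? w e | ∈-tabulate⁻ e∈
  ... | yes k<we | copy∈ = fromℕ< (rev< k<we) , lookup⇒[]= _ (I e) copy∈
  ... | no _     | ()

unfold : ∀ {n} (w : Fin n → ℕ) → Subset n → USubset w
unfold w I' e with e ∈? I'
... | yes _ = ⊤
... | no  _ = ⊥

module _ {n : ℕ} (w : Fin n → ℕ) (I' : Subset n) where

  unfold-nonempty⁻ : ∀ {e} → Nonempty (unfold w I' e) → e ∈ I'
  unfold-nonempty⁻ {e} (_ , copy∈) with e ∈? I'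
  ... | yes e∈I' = e∈I'
  ... | no  _    = contradiction copy∈ ∉⊥

  ucard-unfold : ucard (unfold w I') ≡ weight w I'
  ucard-unfold = sumFin-cong n copies
    where
    copies : ∀ e → ∣ unfold w I' e ∣ ≡ weight-summand w I' e
    copies e with e ∈? I'
    ... | yes _ = ∣⊤∣≡n (w e)
    ... | no  _ = ∣⊥∣≡0 (w e)

  layer₁-unfold-⊆ : ∀ k → layer₁ (unfold w I') k ⊆ I'
  layer₁-unfold-⊆ k = unfold-nonempty⁻ ∘ layer₁-nonempty (unfold w I') k

  layer₂-unfold-⊆ : ∀ k → layer₂ (unfold w I') k ⊆ I'
  layer₂-unfold-⊆ k = unfold-nonempty⁻ ∘ layer₂-nonempty (unfold w I') k

lemma3 : (n W : ℕ) (w : Fin n → ℕ) → (∀ e → 1 ≤ w e × w e ≤ W) →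
         (M₁' M₂' : Matroid n) →
         (I' : Subset n) → Indep M₁' I' → Indep M₂' I' →
         Σ (USubset w) (λ I → UIndep₁ W w M₁' I × UIndep₂ W w M₂' I × weight w I' ≤ ucard I)
lemma3 n W w _ M₁' M₂' I' indep₁ indep₂ =
  unfold w I' ,
  (λ i → indep-⊆ M₁' (layer₁-unfold-⊆ w I' (toℕ i)) indep₁) ,
  (λ i → indep-⊆ M₂' (layer₂-unfold-⊆ w I' (toℕ i)) indep₂) ,
  ≤-reflexive (sym (ucard-unfold w I'))
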